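{- Let $p$ be a prime, $M=M[A]$ a simple, coloopless $p$-matroid on ground set $E$ (with $A$ a matrix over $GF(p)$), $a,b\in E$ distinct, $\alpha\in GF(p)$ nonzero and $e\in\{a,b\}$. Then the $es$-splitting matroid $M^e_{a,b}$ is not bipartite, i.e. it has a circuit of odd size.
   Context: A $p$-matroid is a matroid representable over $GF(p)$. $A'_{a,b}$ is obtained from $A$ by appending a new last row with entries $\alpha$ in columns $a,b$ and $0$ elsewhere, and then a new column $z$ with last coordinate $\alpha$ and all other coordinates $0$. $A^e_{a,b}$ is obtained from $A'_{a,b}$ by appending a column $\gamma$ equal to (column of $e$ in $A'_{a,b}$) minus (column $z$); $M^e_{a,b}$ is the vector matroid of $A^e_{a,b}$ on $E\cup\{z,\gamma\}$. A matroid is bipartite if every circuit has even size. -}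

module Defs where

open import Data.Nat using (ℕ; zero; suc; _<_; _%_) renaming (_+_ to _+ℕ_)
open import Data.Integer using (ℤ; +_; _+_; _*_; _-_)
open import Data.Integer.Divisibility using (_∣_)
open import Data.Fin using (Fin; zero; suc; splitAt; _↑ˡ_; _↑ʳ_; _≟_)
open import Data.Fin.Subset using (Subset; _∈_; _∉_; _⊆_; ∣_∣)
open import Data.Sum using (_⊎_; inj₁; inj₂)
open import Data.Product using (Σ; _×_; ∃)
open import Relation.Nullary using (¬_; yes; no)
open import Relation.Binary.PropositionalEquality using (_≡_)

-- A matrix with m rows and n columns. Entries are integers, read modulo p,
-- i.e. they represent elements of GF(p) = ℤ/pℤ.
Matrix : ℕ → ℕ → Set
Matrix m n = Fin m → Fin n → ℤ

Σℤ : ∀ n → (Fin n → ℤ) → ℤ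
Σℤ zero    f = + 0
Σℤ (suc n) f = f zero + Σℤ n (λ j → f (suc j))

-- A set S of columns of A is linearly dependent over GF(p): there are
-- coefficients c (elements of GF(p), lifted to ℤ), vanishing mod p outside S
-- and not all vanishing mod p on S, with Σ_j c_j · (column j) ≡ 0 (mod p).
Dependent : (p : ℕ) {m n : ℕ} → Matrix m n → Subset n → Set
Dependent p {m} {n} A S =
  Σ (Fin n → ℤ) λ c →
    (∀ j → j ∉ S → (+ p) ∣ c j)
    × (∃ λ j → j ∈ S × ¬ ((+ p) ∣ c j))
    × (∀ i → (+ p) ∣ Σℤ n (λ j → c j * A i j))

Circuit : (p : ℕ) {m n : ℕ} → Matrix m n → Subset n → Set
Circuit p A C = Dependent p A C × (∀ T → T ⊆ C → Dependent p A T → C ⊆ T)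

-- M[A] is simple: no loops and no parallel pairs, i.e. no circuit of size 1 or 2.
Simple : (p : ℕ) {m n : ℕ} → Matrix m n → Set
Simple p {m} {n} A = ∀ C → Circuit p A C → 2 < ∣ C ∣

Coloop : (p : ℕ) {m n : ℕ} → Matrix m n → Fin n → Set
Coloop p {m} {n} A e = ∀ C → Circuit p A C → e ∉ C

Coloopless : (p : ℕ) {m n : ℕ} → Matrix m n → Set
Coloopless p {m} {n} A = ∀ e → ¬ Coloop p A e

Bipartite : (p : ℕ) {m n : ℕ} → Matrix m n → Set
Bipartite p {m} {n} A = ∀ C → Circuit p A C → ∣ C ∣ % 2 ≡ 0

-- A'_{a,b}: new last row (α in columns a, b; 0 elsewhere), then new last
-- column z = (0,…,0,α)ᵀ.  Rows: Fin (m + 1), columns: Fin (n + 1);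
-- the new row is m ↑ʳ zero, the column z is n ↑ʳ zero.
A′ : ∀ {m n} → Matrix m n → Fin n → Fin n → ℤ → Matrix (m +ℕ 1) (n +ℕ 1)
A′ {m} {n} A a b α i j with splitAt m i | splitAt n j
... | inj₁ r | inj₁ c = A r c
... | inj₁ r | inj₂ _ = + 0
... | inj₂ _ | inj₁ c with c ≟ a | c ≟ b
...   | yes _ | _     = α
...   | no _  | yes _ = α
...   | no _  | no _  = + 0
A′ {m} {n} A a b α i j | inj₂ _ | inj₂ _ = α

zcol : ∀ n → Fin (n +ℕ 1)
zcol n = n ↑ʳ zero

-- A^e_{a,b}: append column γ = (column of e in A'_{a,b}) − (column z).
-- Columns: Fin ((n + 1) + 1); E = columns j ↑ˡ 1 ↑ˡ 1, z = zcol n ↑ˡ 1,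
-- γ = (n + 1) ↑ʳ zero.
Ae : ∀ {m n} → Matrix m n → Fin n → Fin n → ℤ → Fin n
     → Matrix (m +ℕ 1) ((n +ℕ 1) +ℕ 1)
Ae {m} {n} A a b α e i j with splitAt (n +ℕ 1) j
... | inj₁ k = A′ A a b α i k
... | inj₂ _ = A′ A a b α i (e ↑ˡ 1) - A′ A a b α i (zcol n)

{-# OPTIONS --safe #-}
module Submission where

-- The odd circuit is {e, z, γ}, dependent because γ = e − z.  It is minimal: a dependency
-- c supported on it gives, in a row of A where column e is nonzero (e is not a loop since
-- M is simple), (c_e + c_γ)·A_re ≡ 0, and in the new row, where e and z both carry α ≢ 0,
-- (c_e + c_z)·α ≡ 0.  So the three coefficients vanish mod p together, and every dependent
-- subset of {e, z, γ} is all of it.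

open import Defs
open import Data.Nat using (ℕ; _%_)
open import Data.Nat.Primality using (Prime)
open import Data.Integer using (ℤ; +_)
open import Data.Integer.Divisibility using (_∣_)
open import Data.Fin using (Fin)
open import Data.Fin.Subset using (Subset; ∣_∣)
open import Data.Sum using (_⊎_)
open import Data.Product using (Σ; _×_)
open import Relation.Nullary using (¬_)
open import Relation.Binary.PropositionalEquality using (_≡_; _≢_)

import Data.Nat as ℕ
import Data.Nat.Divisibility as ℕ
open import Data.Nat.Primality using (euclidsLemma; prime⇒nonTrivial)
open import Data.Integer using (_+_; _*_; _-_; -1ℤ; 0ℤ; 1ℤ) renaming (∣_∣ to abs)
open import Data.Integer.Properties
  using (+-identityˡ; +-identityʳ; +-inverseʳ; *-identityˡ; abs-*)
import Data.Integer.Divisibility.Signed as Signed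
open import Data.Integer.Tactic.RingSolver using (solve-∀)
open import Data.Fin using (zero; suc; splitAt; _↑ˡ_; _↑ʳ_; _≟_)
open import Data.Fin.Properties using (splitAt-↑ˡ; splitAt-↑ʳ; ↑ˡ-injective; ¬∀⟶∃¬)
open import Data.Fin.Subset using (_∈_; _∉_; _⊆_; ⁅_⁆; inside; outside)
open import Data.Fin.Subset.Properties using (x∈⁅x⁆; x∈⁅y⁆⇒x≡y; x∉⁅y⁆⇒x≢y; ∣⁅x⁆∣≡1; _∈?_)
open import Data.Vec using ([]; _∷_; _++_; here; there)
open import Data.Sum using (inj₁; inj₂; [_,_]′)
open import Data.Product using (_,_; ∃; proj₁; proj₂)
open import Relation.Nullary using (yes; no; contradiction)
open import Relation.Binary.PropositionalEquality
  using (refl; sym; trans; cong; cong₂; subst; module ≡-Reasoning)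
open ≡-Reasoning

Σℤ-cong : ∀ N {f g : Fin N → ℤ} → (∀ j → f j ≡ g j) → Σℤ N f ≡ Σℤ N g
Σℤ-cong ℕ.zero    f≡g = refl
Σℤ-cong (ℕ.suc N) f≡g = cong₂ _+_ (f≡g zero) (Σℤ-cong N (λ j → f≡g (suc j)))

Σℤ-+ : ∀ N (f g : Fin N → ℤ) → Σℤ N (λ j → f j + g j) ≡ Σℤ N f + Σℤ N g
Σℤ-+ ℕ.zero    f g = refl
Σℤ-+ (ℕ.suc N) f g = begin
  f zero + g zero + Σℤ N (λ j → f (suc j) + g (suc j))
    ≡⟨ cong (λ s → f zero + g zero + s) (Σℤ-+ N _ _) ⟩
  f zero + g zero + (Σℤ N (λ j → f (suc j)) + Σℤ N (λ j → g (suc j)))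
    ≡⟨ interchange (f zero) (g zero) _ _ ⟩
  (f zero + Σℤ N (λ j → f (suc j))) + (g zero + Σℤ N (λ j → g (suc j))) ∎
  where
  interchange : ∀ a b c d → a + b + (c + d) ≡ (a + c) + (b + d)
  interchange = solve-∀

Σℤ-0 : ∀ N → Σℤ N (λ _ → 0ℤ) ≡ 0ℤ
Σℤ-0 ℕ.zero    = refl
Σℤ-0 (ℕ.suc N) = trans (+-identityˡ _) (Σℤ-0 N)

single : ∀ {N} → Fin N → ℤ → Fin N → ℤ
single zero    u zero    = u
single zero    u (suc _) = 0ℤ
single (suc x) u zero    = 0ℤ
single (suc x) u (suc j) = single x u j

single-self : ∀ {N} (x : Fin N) u → single x u x ≡ u
single-self zero    u = refl
single-self (suc x) u = single-self x u

single-other : ∀ {N} {x j : Fin N} u → j ≢ x → single x u j ≡ 0ℤ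
single-other {x = zero}  {zero}  u j≢x = contradiction refl j≢x
single-other {x = zero}  {suc j} u j≢x = refl
single-other {x = suc x} {zero}  u j≢x = refl
single-other {x = suc x} {suc j} u j≢x = single-other u (λ j≡x → j≢x (cong suc j≡x))

Σℤ-single-* : ∀ {N} (x : Fin N) u (f : Fin N → ℤ) → Σℤ N (λ j → single x u j * f j) ≡ u * f x
Σℤ-single-* {ℕ.suc N} zero    u f = trans (cong (λ s → u * f zero + s) (Σℤ-0 N)) (+-identityʳ _)
Σℤ-single-* {ℕ.suc N} (suc x) u f = trans (+-identityˡ _) (Σℤ-single-* x u (λ j → f (suc j)))

Σℤ-single₃-* : ∀ {N} (x y w : Fin N) u v t (f : Fin N → ℤ) →
  Σℤ N (λ j → (single x u j + single y v j + single w t j) * f j) ≡ u * f x + v * f y + t * f w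
Σℤ-single₃-* {N} x y w u v t f = begin
  Σℤ N (λ j → (sx j + sy j + sw j) * f j)
    ≡⟨ Σℤ-cong N (λ j → distrib (sx j) (sy j) (sw j) (f j)) ⟩
  Σℤ N (λ j → sx j * f j + sy j * f j + sw j * f j)
    ≡⟨ Σℤ-+ N _ _ ⟩
  Σℤ N (λ j → sx j * f j + sy j * f j) + Σℤ N (λ j → sw j * f j)
    ≡⟨ cong (_+ Σℤ N (λ j → sw j * f j)) (Σℤ-+ N _ _) ⟩
  Σℤ N (λ j → sx j * f j) + Σℤ N (λ j → sy j * f j) + Σℤ N (λ j → sw j * f j)
    ≡⟨ cong₂ _+_ (cong₂ _+_ (Σℤ-single-* x u f) (Σℤ-single-* y v f)) (Σℤ-single-* w t f) ⟩
  u * f x + v * f y + t * f w ∎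
  where
  sx sy sw : Fin N → ℤ
  sx = single x u
  sy = single y v
  sw = single w t
  distrib : ∀ a b c d → (a + b + c) * d ≡ a * d + b * d + c * d
  distrib = solve-∀

record IsTriple {N} (C : Subset N) (x y w : Fin N) : Set where
  field
    x≢y : x ≢ y
    x≢w : x ≢ w
    y≢w : y ≢ w
    x∈C : x ∈ C
    y∈C : y ∈ C
    w∈C : w ∈ C
    ∈-cases : ∀ {j} → j ∈ C → j ≡ x ⊎ j ≡ y ⊎ j ≡ w

module Modular (p : ℕ) where

  P : ℤ
  P = + p

  ∣0 : P ∣ 0ℤ
  ∣0 = p ℕ.∣0

  ∣-+ : ∀ {a b} → P ∣ a → P ∣ b → P ∣ a + b
  ∣-+ {a} {b} P∣a P∣b = Signed.∣⇒∣ᵤ {P} {a + b}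
    (Signed.∣m∣n⇒∣m+n (Signed.∣ᵤ⇒∣ {P} {a} P∣a) (Signed.∣ᵤ⇒∣ {P} {b} P∣b))

  ∣-+-cancelˡ : ∀ {a b} → P ∣ a + b → P ∣ a → P ∣ b
  ∣-+-cancelˡ {a} {b} P∣a+b P∣a = Signed.∣⇒∣ᵤ {P} {b}
    (Signed.∣m+n∣m⇒∣n (Signed.∣ᵤ⇒∣ {P} {a + b} P∣a+b) (Signed.∣ᵤ⇒∣ {P} {a} P∣a))

  ∣-+-cancelʳ : ∀ {a b} → P ∣ a + b → P ∣ b → P ∣ a
  ∣-+-cancelʳ {a} {b} P∣a+b P∣b = Signed.∣⇒∣ᵤ {P} {a}
    (Signed.∣m+n∣n⇒∣m (Signed.∣ᵤ⇒∣ {P} {a + b} P∣a+b) (Signed.∣ᵤ⇒∣ {P} {b} P∣b))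

  ∣-*ʳ : ∀ {a} b → P ∣ a → P ∣ a * b
  ∣-*ʳ {a} b P∣a = Signed.∣⇒∣ᵤ {P} {a * b} (Signed.∣m⇒∣m*n b (Signed.∣ᵤ⇒∣ {P} {a} P∣a))

  ≡⇒∣- : ∀ {a b} → a ≡ b → P ∣ a - b
  ≡⇒∣- {a} refl = subst (P ∣_) (sym (+-inverseʳ a)) ∣0

  Σℤ-∣ : ∀ N (f : Fin N → ℤ) → (∀ j → P ∣ f j) → P ∣ Σℤ N f
  Σℤ-∣ ℕ.zero    f P∣f = ∣0
  Σℤ-∣ (ℕ.suc N) f P∣f = ∣-+ {f zero} (P∣f zero) (Σℤ-∣ N (λ j → f (suc j)) (λ j → P∣f (suc j)))

  Σℤ-supported₃ : ∀ {N} {x y w : Fin N} → x ≢ y → x ≢ w → y ≢ w → (f : Fin N → ℤ) →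
    (∀ j → j ≢ x → j ≢ y → j ≢ w → P ∣ f j) → P ∣ Σℤ N f → P ∣ f x + f y + f w
  Σℤ-supported₃ {N} {x} {y} {w} x≢y x≢w y≢w f P∣f P∣Σf =
    ∣-+-cancelˡ {Σℤ N rest} (subst (P ∣_) Σf≡ P∣Σf) (Σℤ-∣ N rest P∣rest)
    where
    χ : Fin N → ℤ
    χ j = single x 1ℤ j + single y 1ℤ j + single w 1ℤ j

    rest : Fin N → ℤ
    rest j = f j - χ j * f j

    Σf≡ : Σℤ N f ≡ Σℤ N rest + (f x + f y + f w)
    Σf≡ = begin
      Σℤ N f
        ≡⟨ Σℤ-cong N (λ j → split (f j) (χ j * f j)) ⟩
      Σℤ N (λ j → rest j + χ j * f j)
        ≡⟨ Σℤ-+ N rest (λ j → χ j * f j) ⟩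
      Σℤ N rest + Σℤ N (λ j → χ j * f j)
        ≡⟨ cong (λ s → Σℤ N rest + s) (Σℤ-single₃-* x y w 1ℤ 1ℤ 1ℤ f) ⟩
      Σℤ N rest + (1ℤ * f x + 1ℤ * f y + 1ℤ * f w)
        ≡⟨ cong (λ s → Σℤ N rest + s)
             (cong₂ _+_ (cong₂ _+_ (*-identityˡ (f x)) (*-identityˡ (f y))) (*-identityˡ (f w))) ⟩
      Σℤ N rest + (f x + f y + f w) ∎
      where
      split : ∀ a b → a ≡ (a - b) + b
      split = solve-∀

    rest-in-support : ∀ j → χ j ≡ 1ℤ → P ∣ rest j
    rest-in-support j χj≡1 = ≡⇒∣- (sym (trans (cong (_* f j) χj≡1) (*-identityˡ (f j))))

    P∣rest : ∀ j → P ∣ rest j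
    P∣rest j with j ≟ x | j ≟ y | j ≟ w
    ... | yes refl | _ | _ = rest-in-support x
      (cong₂ _+_ (cong₂ _+_ (single-self x 1ℤ) (single-other 1ℤ x≢y)) (single-other 1ℤ x≢w))
    ... | no j≢x | yes refl | _ = rest-in-support y
      (cong₂ _+_ (cong₂ _+_ (single-other 1ℤ j≢x) (single-self y 1ℤ)) (single-other 1ℤ y≢w))
    ... | no j≢x | no j≢y | yes refl = rest-in-support w
      (cong₂ _+_ (cong₂ _+_ (single-other 1ℤ j≢x) (single-other 1ℤ j≢y)) (single-self w 1ℤ))
    ... | no j≢x | no j≢y | no j≢w = subst (P ∣_) rest≡f (P∣f j j≢x j≢y j≢w)
      where
      χj≡0 : χ j ≡ 0ℤ
      χj≡0 = cong₂ _+_ (cong₂ _+_ (single-other 1ℤ j≢x) (single-other 1ℤ j≢y)) (single-other 1ℤ j≢w)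
      rest≡f : f j ≡ rest j
      rest≡f = sym (trans (cong (λ c → f j - c * f j) χj≡0) (+-identityʳ (f j)))

  module _ (p-prime : Prime p) where

    ∤1 : ¬ P ∣ 1ℤ
    ∤1 P∣1 = ℕ.nonTrivial⇒≢1 {{prime⇒nonTrivial p-prime}} (ℕ.∣1⇒≡1 P∣1)

    ∣-*-∤ʳ : ∀ {a} b → P ∣ a * b → ¬ P ∣ b → P ∣ a
    ∣-*-∤ʳ {a} b P∣ab P∤b with euclidsLemma (abs a) (abs b) p-prime (subst (p ℕ.∣_) (abs-* a b) P∣ab)
    ... | inj₁ P∣a = P∣a
    ... | inj₂ P∣b = contradiction P∣b P∤b

    zero-column-circuit : ∀ {m n} (A : Matrix m n) e → (∀ r → P ∣ A r e) → Circuit p A ⁅ e ⁆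
    zero-column-circuit {n = n} A e P∣col =
      (single e 1ℤ , vanishes-off-e , (e , x∈⁅x⁆ e , P∤coeff) , rows) , minimal
      where
      vanishes-off-e : ∀ j → j ∉ ⁅ e ⁆ → P ∣ single e 1ℤ j
      vanishes-off-e j j∉⁅e⁆ = subst (P ∣_) (sym (single-other 1ℤ (x∉⁅y⁆⇒x≢y j∉⁅e⁆))) ∣0

      P∤coeff : ¬ P ∣ single e 1ℤ e
      P∤coeff = subst (λ c → ¬ P ∣ c) (sym (single-self e 1ℤ)) ∤1

      rows : ∀ r → P ∣ Σℤ n (λ j → single e 1ℤ j * A r j)
      rows r = subst (P ∣_) (sym (trans (Σℤ-single-* e 1ℤ (A r)) (*-identityˡ (A r e)))) (P∣col r)

      minimal : ∀ T → T ⊆ ⁅ e ⁆ → Dependent p A T → ⁅ e ⁆ ⊆ T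
      minimal T T⊆⁅e⁆ (_ , _ , (k , k∈T , _) , _) j∈⁅e⁆ =
        subst (_∈ T) (trans (x∈⁅y⁆⇒x≡y e (T⊆⁅e⁆ k∈T)) (sym (x∈⁅y⁆⇒x≡y e j∈⁅e⁆))) k∈T

    simple⇒nonzero-column : ∀ {m n} (A : Matrix m n) → Simple p A → ∀ e → ∃ λ r → ¬ P ∣ A r e
    simple⇒nonzero-column {m} A simple e =
      ¬∀⟶∃¬ m (λ r → P ∣ A r e) (λ r → p ℕ.∣? abs (A r e)) no-loop
      where
      no-loop : ¬ (∀ r → P ∣ A r e)
      no-loop P∣col with subst (2 ℕ.<_) (∣⁅x⁆∣≡1 e) (simple ⁅ e ⁆ (zero-column-circuit A e P∣col))
      ... | ℕ.s≤s ()

    module _ {m N} (B : Matrix m N) {C x y w} (triple : IsTriple C x y w)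
             (w≡x-y : ∀ i → B i w ≡ B i x - B i y) where
      open IsTriple triple

      triple-dependent : Dependent p B C
      triple-dependent = coeff , vanishes-off-C , (x , x∈C , P∤coeff-x) , rows
        where
        coeff : Fin N → ℤ
        coeff j = single x 1ℤ j + single y -1ℤ j + single w -1ℤ j

        ∉C⇒≢ : ∀ {j t} → t ∈ C → j ∉ C → j ≢ t
        ∉C⇒≢ t∈C j∉C refl = j∉C t∈C

        vanishes-off-C : ∀ j → j ∉ C → P ∣ coeff j
        vanishes-off-C j j∉C = subst (P ∣_) (sym coeff-j≡0) ∣0
          where
          coeff-j≡0 : coeff j ≡ 0ℤ
          coeff-j≡0 = cong₂ _+_ (cong₂ _+_ (single-other 1ℤ (∉C⇒≢ x∈C j∉C))
            (single-other -1ℤ (∉C⇒≢ y∈C j∉C))) (single-other -1ℤ (∉C⇒≢ w∈C j∉C))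

        P∤coeff-x : ¬ P ∣ coeff x
        P∤coeff-x = subst (λ c → ¬ P ∣ c) (sym coeff-x≡1) ∤1
          where
          coeff-x≡1 : coeff x ≡ 1ℤ
          coeff-x≡1 = cong₂ _+_ (cong₂ _+_ (single-self x 1ℤ) (single-other -1ℤ x≢y))
            (single-other -1ℤ x≢w)

        rows : ∀ i → P ∣ Σℤ N (λ j → coeff j * B i j)
        rows i = subst (P ∣_) (sym (begin
          Σℤ N (λ j → coeff j * B i j)
            ≡⟨ Σℤ-single₃-* x y w 1ℤ -1ℤ -1ℤ (B i) ⟩
          1ℤ * B i x + -1ℤ * B i y + -1ℤ * B i w
            ≡⟨ cong (λ t → 1ℤ * B i x + -1ℤ * B i y + -1ℤ * t) (w≡x-y i) ⟩
          1ℤ * B i x + -1ℤ * B i y + -1ℤ * (B i x - B i y)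
            ≡⟨ cancel (B i x) (B i y) ⟩
          0ℤ ∎)) ∣0
          where
          cancel : ∀ X Y → 1ℤ * X + -1ℤ * Y + -1ℤ * (X - Y) ≡ 0ℤ
          cancel = solve-∀

      triple-coefficients-linked :
        (∃ λ r → B r y ≡ 0ℤ × ¬ P ∣ B r x) → (∃ λ s → B s y ≡ B s x × ¬ P ∣ B s x) →
        ∀ (c : Fin N → ℤ) → (∀ j → j ≢ x → j ≢ y → j ≢ w → P ∣ c j) →
        (∀ i → P ∣ Σℤ N (λ j → c j * B i j)) →
        (P ∣ c x + c w) × (P ∣ c x + c y)
      triple-coefficients-linked (r , Bry≡0 , P∤Brx) (s , Bsy≡Bsx , P∤Bsx) c c-supported c-rows =
        ∣-*-∤ʳ {c x + c w} (B r x) (subst (P ∣_) row-r (row-relation r)) P∤Brx ,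
        ∣-*-∤ʳ {c x + c y} (B s x) (subst (P ∣_) row-s (row-relation s)) P∤Bsx
        where
        row-relation : ∀ i → P ∣ c x * B i x + c y * B i y + c w * B i w
        row-relation i = Σℤ-supported₃ x≢y x≢w y≢w (λ j → c j * B i j)
          (λ j j≢x j≢y j≢w → ∣-*ʳ {c j} (B i j) (c-supported j j≢x j≢y j≢w)) (c-rows i)

        row-at : ∀ i {Y} → B i y ≡ Y →
          c x * B i x + c y * B i y + c w * B i w ≡ c x * B i x + c y * Y + c w * (B i x - Y)
        row-at i refl = cong (λ t → c x * B i x + c y * B i y + c w * t) (w≡x-y i)

        collect-r : ∀ a b d X → a * X + b * 0ℤ + d * (X - 0ℤ) ≡ (a + d) * X
        collect-r = solve-∀

        collect-s : ∀ a b d X → a * X + b * X + d * (X - X) ≡ (a + b) * X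
        collect-s = solve-∀

        row-r : c x * B r x + c y * B r y + c w * B r w ≡ (c x + c w) * B r x
        row-r = trans (row-at r Bry≡0) (collect-r (c x) (c y) (c w) (B r x))

        row-s : c x * B s x + c y * B s y + c w * B s w ≡ (c x + c y) * B s x
        row-s = trans (row-at s Bsy≡Bsx) (collect-s (c x) (c y) (c w) (B s x))

      triple-circuit :
        (∃ λ r → B r y ≡ 0ℤ × ¬ P ∣ B r x) → (∃ λ s → B s y ≡ B s x × ¬ P ∣ B s x) →
        Circuit p B C
      triple-circuit row-r row-s = triple-dependent , minimal
        where
        minimal : ∀ T → T ⊆ C → Dependent p B T → C ⊆ T
        minimal T T⊆C (c , vanishes-off-T , (k , k∈T , P∤ck) , rows) = C⊆T
          where
          c-supported : ∀ j → j ≢ x → j ≢ y → j ≢ w → P ∣ c j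
          c-supported j j≢x j≢y j≢w =
            vanishes-off-T j λ j∈T → [ j≢x , [ j≢y , j≢w ]′ ]′ (∈-cases (T⊆C j∈T))

          linked : (P ∣ c x + c w) × (P ∣ c x + c y)
          linked = triple-coefficients-linked row-r row-s c c-supported rows

          P∣cx+cw : P ∣ c x + c w
          P∣cx+cw = proj₁ linked

          P∣cx+cy : P ∣ c x + c y
          P∣cx+cy = proj₂ linked

          P∤cx : ¬ P ∣ c x
          P∤cx P∣cx with ∈-cases (T⊆C k∈T)
          ... | inj₁ refl        = P∤ck P∣cx
          ... | inj₂ (inj₁ refl) = P∤ck (∣-+-cancelˡ {c x} P∣cx+cy P∣cx)
          ... | inj₂ (inj₂ refl) = P∤ck (∣-+-cancelˡ {c x} P∣cx+cw P∣cx)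

          ∤⇒∈T : ∀ t → ¬ P ∣ c t → t ∈ T
          ∤⇒∈T t P∤ct with t ∈? T
          ... | yes t∈T = t∈T
          ... | no  t∉T = contradiction (vanishes-off-T t t∉T) P∤ct

          C⊆T : C ⊆ T
          C⊆T j∈C with ∈-cases j∈C
          ... | inj₁ refl        = ∤⇒∈T x P∤cx
          ... | inj₂ (inj₁ refl) = ∤⇒∈T y (λ P∣cy → P∤cx (∣-+-cancelʳ {c x} P∣cx+cy P∣cy))
          ... | inj₂ (inj₂ refl) = ∤⇒∈T w (λ P∣cw → P∤cx (∣-+-cancelʳ {c x} P∣cx+cw P∣cw))

∈-++⁺ˡ : ∀ {k l} {p : Subset k} {q : Subset l} {i} → i ∈ p → (i ↑ˡ l) ∈ (p ++ q)
∈-++⁺ˡ here        = here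
∈-++⁺ˡ (there i∈p) = there (∈-++⁺ˡ i∈p)

∈-++⁺ʳ : ∀ {k l} (p : Subset k) {q : Subset l} {i} → i ∈ q → (k ↑ʳ i) ∈ (p ++ q)
∈-++⁺ʳ []      i∈q = i∈q
∈-++⁺ʳ (_ ∷ p) i∈q = there (∈-++⁺ʳ p i∈q)

∈-++⁻ : ∀ {k l} (p : Subset k) {q : Subset l} {j} → j ∈ (p ++ q) →
  (∃ λ i → j ≡ i ↑ˡ l × i ∈ p) ⊎ (∃ λ i → j ≡ k ↑ʳ i × i ∈ q)
∈-++⁻ []      j∈q = inj₂ (_ , refl , j∈q)
∈-++⁻ (_ ∷ p) here = inj₁ (zero , refl , here)
∈-++⁻ (_ ∷ p) (there j∈p++q) with ∈-++⁻ p j∈p++q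
... | inj₁ (i , refl , i∈p) = inj₁ (suc i , refl , there i∈p)
... | inj₂ (i , refl , i∈q) = inj₂ (i , refl , i∈q)

∣p++q∣ : ∀ {k l} (p : Subset k) (q : Subset l) → ∣ p ++ q ∣ ≡ ∣ p ∣ ℕ.+ ∣ q ∣
∣p++q∣ []            q = refl
∣p++q∣ (inside ∷ p)  q = cong ℕ.suc (∣p++q∣ p q)
∣p++q∣ (outside ∷ p) q = ∣p++q∣ p q

↑ˡ≢↑ʳ : ∀ {k l} (i : Fin k) (j : Fin l) → i ↑ˡ l ≢ k ↑ʳ j
↑ˡ≢↑ʳ {k} {l} i j eq with trans (sym (splitAt-↑ˡ k i l)) (trans (cong (splitAt k) eq) (splitAt-↑ʳ k l j))
... | ()

module SplittingColumns {n} (e : Fin n) where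

  e′ z γ : Fin ((n ℕ.+ 1) ℕ.+ 1)
  e′ = (e ↑ˡ 1) ↑ˡ 1
  z  = zcol n ↑ˡ 1
  γ  = (n ℕ.+ 1) ↑ʳ zero

  Cₑ : Subset ((n ℕ.+ 1) ℕ.+ 1)
  Cₑ = (⁅ e ⁆ ++ (inside ∷ [])) ++ (inside ∷ [])

  ∣Cₑ∣≡3 : ∣ Cₑ ∣ ≡ 3
  ∣Cₑ∣≡3 = begin
    ∣ Cₑ ∣                           ≡⟨ ∣p++q∣ (⁅ e ⁆ ++ (inside ∷ [])) (inside ∷ []) ⟩
    ∣ ⁅ e ⁆ ++ (inside ∷ []) ∣ ℕ.+ 1  ≡⟨ cong (ℕ._+ 1) (∣p++q∣ ⁅ e ⁆ (inside ∷ [])) ⟩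
    ∣ ⁅ e ⁆ ∣ ℕ.+ 1 ℕ.+ 1             ≡⟨ cong (λ s → s ℕ.+ 1 ℕ.+ 1) (∣⁅x⁆∣≡1 e) ⟩
    3                                ∎

  Cₑ-triple : IsTriple Cₑ e′ z γ
  Cₑ-triple = record
    { x≢y     = λ eq → ↑ˡ≢↑ʳ e zero (↑ˡ-injective 1 (e ↑ˡ 1) (zcol n) eq)
    ; x≢w     = ↑ˡ≢↑ʳ (e ↑ˡ 1) zero
    ; y≢w     = ↑ˡ≢↑ʳ (zcol n) zero
    ; x∈C     = ∈-++⁺ˡ (∈-++⁺ˡ (x∈⁅x⁆ e))
    ; y∈C     = ∈-++⁺ˡ (∈-++⁺ʳ ⁅ e ⁆ here)
    ; w∈C     = ∈-++⁺ʳ (⁅ e ⁆ ++ (inside ∷ [])) here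
    ; ∈-cases = ∈-cases
    }
    where
    ∈-cases : ∀ {j} → j ∈ Cₑ → j ≡ e′ ⊎ j ≡ z ⊎ j ≡ γ
    ∈-cases j∈Cₑ with ∈-++⁻ (⁅ e ⁆ ++ (inside ∷ [])) j∈Cₑ
    ... | inj₂ (zero , refl , _) = inj₂ (inj₂ refl)
    ... | inj₁ (i , refl , i∈) with ∈-++⁻ ⁅ e ⁆ i∈
    ...   | inj₂ (zero , refl , _) = inj₂ (inj₁ refl)
    ...   | inj₁ (k , refl , k∈⁅e⁆) with x∈⁅y⁆⇒x≡y e k∈⁅e⁆
    ...     | refl = inj₁ refl

module _ {m n} (A : Matrix m n) (a b : Fin n) (α : ℤ) (e : Fin n) where
  open SplittingColumns e

  private
    B : Matrix (m ℕ.+ 1) ((n ℕ.+ 1) ℕ.+ 1)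
    B = Ae A a b α e

  Ae-γ : ∀ i → B i γ ≡ B i e′ - B i z
  Ae-γ i rewrite splitAt-↑ʳ (n ℕ.+ 1) 1 zero
               | splitAt-↑ˡ (n ℕ.+ 1) (e ↑ˡ 1) 1
               | splitAt-↑ˡ (n ℕ.+ 1) (zcol n) 1 = refl

  Ae-old-row-e : ∀ r → B (r ↑ˡ 1) e′ ≡ A r e
  Ae-old-row-e r rewrite splitAt-↑ˡ (n ℕ.+ 1) (e ↑ˡ 1) 1 | splitAt-↑ˡ m r 1 | splitAt-↑ˡ n e 1 = refl

  Ae-old-row-z : ∀ r → B (r ↑ˡ 1) z ≡ 0ℤ
  Ae-old-row-z r rewrite splitAt-↑ˡ (n ℕ.+ 1) (zcol n) 1 | splitAt-↑ˡ m r 1 | splitAt-↑ʳ n 1 zero = refl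

  Ae-new-row-z : B (m ↑ʳ zero) z ≡ α
  Ae-new-row-z rewrite splitAt-↑ˡ (n ℕ.+ 1) (zcol n) 1 | splitAt-↑ʳ m 1 zero | splitAt-↑ʳ n 1 zero = refl

  Ae-new-row-e : e ≡ a ⊎ e ≡ b → B (m ↑ʳ zero) e′ ≡ α
  Ae-new-row-e e∈ab rewrite splitAt-↑ˡ (n ℕ.+ 1) (e ↑ˡ 1) 1 | splitAt-↑ʳ m 1 zero | splitAt-↑ˡ n e 1
    with e ≟ a | e ≟ b | e∈ab
  ... | yes _ | _     | _        = refl
  ... | no _  | yes _ | _        = refl
  ... | no e≢a | no _ | inj₁ e≡a = contradiction e≡a e≢a
  ... | no _  | no e≢b | inj₂ e≡b = contradiction e≡b e≢b

corollary2p5 : (p : ℕ) → Prime p → {m n : ℕ} → (A : Matrix m n)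
    → Simple p A → Coloopless p A
    → (a b : Fin n) → a ≢ b
    → (α : ℤ) → ¬ ((+ p) ∣ α)
    → (e : Fin n) → e ≡ a ⊎ e ≡ b
    → Σ (Subset _) λ C → Circuit p (Ae A a b α e) C × ∣ C ∣ % 2 ≡ 1
corollary2p5 p p-prime {m} A simple _ a b _ α P∤α e e∈ab =
  Cₑ , triple-circuit p-prime (Ae A a b α e) Cₑ-triple (Ae-γ A a b α e) old-row new-row , odd
  where
  open Modular p
  open SplittingColumns e

  old-row : ∃ λ r → Ae A a b α e r z ≡ 0ℤ × ¬ P ∣ Ae A a b α e r e′
  old-row with simple⇒nonzero-column p-prime A simple e
  ... | r , P∤Are = r ↑ˡ 1
                  , Ae-old-row-z A a b α e r
                  , subst (λ v → ¬ P ∣ v) (sym (Ae-old-row-e A a b α e r)) P∤Are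

  new-row : ∃ λ s → Ae A a b α e s z ≡ Ae A a b α e s e′ × ¬ P ∣ Ae A a b α e s e′
  new-row = m ↑ʳ zero
          , trans (Ae-new-row-z A a b α e) (sym (Ae-new-row-e A a b α e e∈ab))
          , subst (λ v → ¬ P ∣ v) (sym (Ae-new-row-e A a b α e e∈ab)) P∤α

  odd : ∣ Cₑ ∣ % 2 ≡ 1
  odd = cong (_% 2) ∣Cₑ∣≡3
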